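{- Let $\mathbf{x}=(x_1,x_2,\dots)$ and $\mathbf{y}=(y_1,y_2,\dots)$ be elements of $\ell^1(\mathbb{Z}_3)$. If $$\sum_{j\ge1}\frac{(\mathbf{x}+\mathbf{y})_j}{j+1}=\sum_{j\ge1}\frac{x_j}{j+1}+\sum_{j\ge1}\frac{y_j}{j+1}$$ and $\mathbf{z}(\mathbf{x},\mathbf{y})=0$, then the point $(a,b)$ with $a=\sum_{j\ge1}x_j3^{ -j}$ and $b=\sum_{j\ge1}y_j3^{ -j}$ (i.e. $a=[0.x_1x_2\dots]_3$, $b=[0.y_1y_2\dots]_3$ in balanced ternary) lies in the hexagon snowflake fractal $S_F$.
   Context: $\ell^1(\mathbb{Z}_3)$ is the set of sequences with entries in $\{ -1,0,1\}$ having only finitely many nonzero entries, with addition componentwise modulo $3$ using representatives $\{ -1,0,1\}$. The vector $\mathbf{z}(\mathbf{x},\mathbf{y})$ has $j$-th component $1$ if $x_j=y_j=1$, $-1$ if $x_j=y_j=-1$, $0$ otherwise. The hexagon snowflake fractal: let $H_0$ be the hexagon with vertices $(\tfrac12,0),(0,\tfrac12),(-\tfrac12,\tfrac12),(-\tfrac12,0),(0,-\tfrac12),(\tfrac12,-\tfrac12)$, i.e. $\{(x,y)\in[-\tfrac12,\tfrac12]^2:-\tfrac12\le x+y\le\tfrac12\}$, from which the two triangles with vertices $(\tfrac13,\tfrac16),(\tfrac16,\tfrac16),(\tfrac16,\tfrac13)$ and $(-\tfrac13,-\tfrac16),(-\tfrac16,-\tfrac16),(-\tfrac16,-\tfrac13)$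 are removed, namely the points with $x>\tfrac16,y>\tfrac16$ and those with $x<-\tfrac16,y<-\tfrac16$. Let $v_0=(0,0)$, $v_1=(\tfrac13,0)$, $v_2=(0,\tfrac13)$, $v_3=(\tfrac13,-\tfrac13)$, $v_4=-v_1$, $v_5=-v_2$, $v_6=-v_3$. Set $G_0=H_0$ and $G_{j}=\bigcup_{i=0}^6\big(\tfrac13G_{j-1}+v_i\big)$ for $j\ge1$; $S_F=\bigcap_{n\ge0}G_n$. -}

module Defs where

open import Data.Nat using (ℕ; zero; suc)
open import Data.Integer using (ℤ; +_; -[1+_])
open import Data.Rational using (ℚ; 0ℚ; _+_; _*_; _/_; _≤_; _<_; -_)
open import Data.Vec using (Vec; []; _∷_; replicate)
open import Data.Fin using (Fin; zero; suc)
open import Data.Product using (_×_; ∃)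
open import Relation.Nullary using (¬_)

-- Entries of ℓ¹(ℤ₃): balanced representatives {-1,0,1}
data Trit : Set where
  m1 z0 p1 : Trit

toℤ : Trit → ℤ
toℤ m1 = -[1+ 0 ]
toℤ z0 = + 0
toℤ p1 = + 1

toℚ : Trit → ℚ
toℚ t = toℤ t / 1

_⊕_ : Trit → Trit → Trit
z0 ⊕ t  = t
t  ⊕ z0 = t
p1 ⊕ p1 = m1
m1 ⊕ m1 = p1
p1 ⊕ m1 = z0
m1 ⊕ p1 = z0

zt : Trit → Trit → Trit
zt p1 p1 = p1
zt m1 m1 = m1
zt _  _  = z0

-- Finitely supported sequences x_1, x_2, ... are represented by their first n
-- entries (all later entries being 0); a pair of elements of ℓ¹(ℤ₃) is a pair
-- of vectors of a common length n.
vadd : ∀ {n} → Vec Trit n → Vec Trit n → Vec Trit n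
vadd [] [] = []
vadd (a ∷ as) (b ∷ bs) = (a ⊕ b) ∷ vadd as bs

zvec : ∀ {n} → Vec Trit n → Vec Trit n → Vec Trit n
zvec [] [] = []
zvec (a ∷ as) (b ∷ bs) = zt a b ∷ zvec as bs

weightedFrom : ∀ {n} → ℕ → Vec Trit n → ℚ
weightedFrom k [] = 0ℚ
weightedFrom k (t ∷ ts) = toℚ t * ((+ 1) / suc k) + weightedFrom (suc k) ts

weighted : ∀ {n} → Vec Trit n → ℚ
weighted = weightedFrom 1

ternary : ∀ {n} → Vec Trit n → ℚ
ternary [] = 0ℚ
ternary (t ∷ ts) = (toℚ t + ternary ts) * ((+ 1) / 3)

-- points of ℚ² (the relevant points have rational coordinates)
Point : Set
Point = ℚ × ℚ

half sixth third : ℚ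
half = (+ 1) / 2
sixth = (+ 1) / 6
third = (+ 1) / 3

-- H₀: the hexagon minus the two (open-cornered) triangles
InH0 : ℚ → ℚ → Set
InH0 x y =
  (- half ≤ x) × (x ≤ half) × (- half ≤ y) × (y ≤ half)
  × (- half ≤ x + y) × (x + y ≤ half)
  × ¬ ((sixth < x) × (sixth < y))
  × ¬ ((x < - sixth) × (y < - sixth))

vx vy : Fin 7 → ℚ
vx zero = 0ℚ
vx (suc zero) = third
vx (suc (suc zero)) = 0ℚ
vx (suc (suc (suc zero))) = third
vx (suc (suc (suc (suc zero)))) = - third
vx (suc (suc (suc (suc (suc zero))))) = 0ℚ
vx (suc (suc (suc (suc (suc (suc zero)))))) = - third
vy zero = 0ℚ
vy (suc zero) = 0ℚ
vy (suc (suc zero)) = third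
vy (suc (suc (suc zero))) = - third
vy (suc (suc (suc (suc zero)))) = 0ℚ
vy (suc (suc (suc (suc (suc zero))))) = - third
vy (suc (suc (suc (suc (suc (suc zero)))))) = third

three : ℚ
three = (+ 3) / 1

-- membership in G_n:  p ∈ G_{n+1} = ⋃ᵢ (⅓ G_n + vᵢ)  iff  ∃ i, 3(p − vᵢ) ∈ G_n
InG : ℕ → ℚ → ℚ → Set
InG zero x y = InH0 x y
InG (suc n) x y = ∃ λ (i : Fin 7) → InG n (three * (x + - vx i)) (three * (y + - vy i))

InSF : ℚ → ℚ → Set
InSF x y = ∀ n → InG n x y

-- A digit pair (t, s) with zt t s = 0 is 3vᵢ for one of the seven translations vᵢ, and prepending
-- it to the balanced ternary expansions acts on the point p = (a, b) as p ↦ p/3 + vᵢ, which maps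
-- G_k into G_(k+1) by the very definition of G_(k+1). For these seven pairs the same map also sends
-- H₀ into itself, so by induction on the digits the point lies in H₀ = G₀, and then by induction on
-- k in every G_k.
module Submission where

open import Defs
open import Data.Nat using (ℕ; zero; suc)
open import Data.Vec using (Vec; []; _∷_; replicate)
open import Data.Vec.Properties using (∷-injectiveˡ; ∷-injectiveʳ)
open import Data.Fin using (zero; suc)
open import Data.Rational using (ℚ; 0ℚ; _+_; _*_; -_; _≤_; _<_; _≤?_; _<?_)
open import Data.Rational.Properties using (≤-trans; <-irrefl; <-≤-trans; +-monoʳ-≤; *-monoʳ-≤-nonNeg)
open import Data.Rational.Solver using (module +-*-Solver)
open import Data.Product using (_×_; _,_; ∃)
open import Data.Sum using (_⊎_; inj₁; inj₂)
open import Relation.Binary.PropositionalEquality using (_≡_; refl; sym; subst₂)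
open import Relation.Nullary using (Dec; ¬_; ¬?)
open import Relation.Nullary.Decidable using (_×-dec_; _⊎-dec_; from-yes)

open +-*-Solver

-- ternary (t ∷ ts) is definitionally contract (toℚ t) (ternary ts).
contract : ℚ → ℚ → ℚ
contract c r = (c + r) * third

contract-monoʳ-≤ : ∀ c {r s} → r ≤ s → contract c r ≤ contract c s
contract-monoʳ-≤ c r≤s = *-monoʳ-≤-nonNeg third (+-monoʳ-≤ c r≤s)

contract-+ : ∀ a b u w → contract a u + contract b w ≡ contract (a + b) (u + w)
contract-+ = solve 4 (λ a b u w →
  (a :+ u) :* con third :+ (b :+ w) :* con third := ((a :+ b) :+ (u :+ w)) :* con third) refl

three*[contract-c*third]≡id : ∀ c r → three * (contract c r + - (c * third)) ≡ r
three*[contract-c*third]≡id = solve 2 (λ c r →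
  con three :* ((c :+ r) :* con third :+ :- (c :* con third)) := r) refl

inH0? : ∀ x y → Dec (InH0 x y)
inH0? x y =
  (- half ≤? x) ×-dec (x ≤? half) ×-dec (- half ≤? y) ×-dec (y ≤? half)
  ×-dec (- half ≤? x + y) ×-dec (x + y ≤? half)
  ×-dec ¬? ((sixth <? x) ×-dec (sixth <? y))
  ×-dec ¬? ((x <? - sixth) ×-dec (y <? - sixth))

-- As contract is monotone and additive, each constraint of H₀ on the image only needs checking at
-- the extreme value ±½ of the matching constraint on the preimage.
DigitsFitH0 : ℚ → ℚ → Set
DigitsFitH0 a b =
  (- half ≤ contract a (- half)) × (contract a half ≤ half)
  × (- half ≤ contract b (- half)) × (contract b half ≤ half)
  × (- half ≤ contract (a + b) (- half)) × (contract (a + b) half ≤ half)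
  × ((contract a half ≤ sixth) ⊎ (contract b half ≤ sixth))
  × ((- sixth ≤ contract a (- half)) ⊎ (- sixth ≤ contract b (- half)))

digitsFitH0? : ∀ a b → Dec (DigitsFitH0 a b)
digitsFitH0? a b =
  (- half ≤? contract a (- half)) ×-dec (contract a half ≤? half)
  ×-dec (- half ≤? contract b (- half)) ×-dec (contract b half ≤? half)
  ×-dec (- half ≤? contract (a + b) (- half)) ×-dec (contract (a + b) half ≤? half)
  ×-dec ((contract a half ≤? sixth) ⊎-dec (contract b half ≤? sixth))
  ×-dec ((- sixth ≤? contract a (- half)) ⊎-dec (- sixth ≤? contract b (- half)))

contract-preserves-H0 : ∀ a b {u w} → DigitsFitH0 a b → InH0 u w → InH0 (contract a u) (contract b w)
contract-preserves-H0 a b {u} {w}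
  (a-lo , a-hi , b-lo , b-hi , ab-lo , ab-hi , top , bottom)
  (u-lo , u-hi , w-lo , w-hi , uw-lo , uw-hi , _ , _) =
  ≤-trans a-lo (contract-monoʳ-≤ a u-lo) , ≤-trans (contract-monoʳ-≤ a u-hi) a-hi ,
  ≤-trans b-lo (contract-monoʳ-≤ b w-lo) , ≤-trans (contract-monoʳ-≤ b w-hi) b-hi ,
  subst₂ _≤_ refl (sym (contract-+ a b u w)) (≤-trans ab-lo (contract-monoʳ-≤ (a + b) uw-lo)) ,
  subst₂ _≤_ (sym (contract-+ a b u w)) refl (≤-trans (contract-monoʳ-≤ (a + b) uw-hi) ab-hi) ,
  avoids-top top , avoids-bottom bottom
  where
  avoids-top : (contract a half ≤ sixth) ⊎ (contract b half ≤ sixth) →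
    ¬ ((sixth < contract a u) × (sixth < contract b w))
  avoids-top (inj₁ h) (above , _) = <-irrefl refl (<-≤-trans above (≤-trans (contract-monoʳ-≤ a u-hi) h))
  avoids-top (inj₂ h) (_ , above) = <-irrefl refl (<-≤-trans above (≤-trans (contract-monoʳ-≤ b w-hi) h))
  avoids-bottom : (- sixth ≤ contract a (- half)) ⊎ (- sixth ≤ contract b (- half)) →
    ¬ ((contract a u < - sixth) × (contract b w < - sixth))
  avoids-bottom (inj₁ h) (below , _) = <-irrefl refl (<-≤-trans below (≤-trans h (contract-monoʳ-≤ a u-lo)))
  avoids-bottom (inj₂ h) (_ , below) = <-irrefl refl (<-≤-trans below (≤-trans h (contract-monoʳ-≤ b w-lo)))

allowed-digits-fit-H0 : ∀ t s → zt t s ≡ z0 → DigitsFitH0 (toℚ t) (toℚ s)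
allowed-digits-fit-H0 m1 m1 ()
allowed-digits-fit-H0 p1 p1 ()
allowed-digits-fit-H0 z0 z0 _ = from-yes (digitsFitH0? (toℚ z0) (toℚ z0))
allowed-digits-fit-H0 p1 z0 _ = from-yes (digitsFitH0? (toℚ p1) (toℚ z0))
allowed-digits-fit-H0 z0 p1 _ = from-yes (digitsFitH0? (toℚ z0) (toℚ p1))
allowed-digits-fit-H0 p1 m1 _ = from-yes (digitsFitH0? (toℚ p1) (toℚ m1))
allowed-digits-fit-H0 m1 z0 _ = from-yes (digitsFitH0? (toℚ m1) (toℚ z0))
allowed-digits-fit-H0 z0 m1 _ = from-yes (digitsFitH0? (toℚ z0) (toℚ m1))
allowed-digits-fit-H0 m1 p1 _ = from-yes (digitsFitH0? (toℚ m1) (toℚ p1))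

ternary-InH0 : ∀ {m} (xs ys : Vec Trit m) → zvec xs ys ≡ replicate m z0 →
  InH0 (ternary xs) (ternary ys)
ternary-InH0 [] [] _ = from-yes (inH0? 0ℚ 0ℚ)
ternary-InH0 (t ∷ xs) (s ∷ ys) z≡0 =
  contract-preserves-H0 (toℚ t) (toℚ s) (allowed-digits-fit-H0 t s (∷-injectiveˡ z≡0))
    (ternary-InH0 xs ys (∷-injectiveʳ z≡0))

allowed-digits-translation : ∀ t s → zt t s ≡ z0 →
  ∃ λ i → vx i ≡ toℚ t * third × vy i ≡ toℚ s * third
allowed-digits-translation m1 m1 ()
allowed-digits-translation p1 p1 ()
allowed-digits-translation z0 z0 _ = zero , refl , refl
allowed-digits-translation p1 z0 _ = suc zero , refl , refl
allowed-digits-translation z0 p1 _ = suc (suc zero) , refl , refl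
allowed-digits-translation p1 m1 _ = suc (suc (suc zero)) , refl , refl
allowed-digits-translation m1 z0 _ = suc (suc (suc (suc zero))) , refl , refl
allowed-digits-translation z0 m1 _ = suc (suc (suc (suc (suc zero)))) , refl , refl
allowed-digits-translation m1 p1 _ = suc (suc (suc (suc (suc (suc zero))))) , refl , refl

contract-preserves-InG : ∀ k i a b {u w} → vx i ≡ a * third → vy i ≡ b * third →
  InG k u w → InG (suc k) (contract a u) (contract b w)
contract-preserves-InG k i a b {u} {w} vx≡ vy≡ uw∈G =
  i , subst₂ (InG k) (sym (rescale a u vx≡)) (sym (rescale b w vy≡)) uw∈G
  where
  rescale : ∀ c r {v} → v ≡ c * third → three * (contract c r + - v) ≡ r
  rescale c r refl = three*[contract-c*third]≡id c r

ternary-InG : ∀ k {m} (xs ys : Vec Trit m) → zvec xs ys ≡ replicate m z0 →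
  InG k (ternary xs) (ternary ys)
ternary-InG zero xs ys z≡0 = ternary-InH0 xs ys z≡0
ternary-InG (suc k) [] [] _ = zero , ternary-InG k [] [] refl
ternary-InG (suc k) (t ∷ xs) (s ∷ ys) z≡0
  with i , vx≡ , vy≡ ← allowed-digits-translation t s (∷-injectiveˡ z≡0) =
  contract-preserves-InG k i (toℚ t) (toℚ s) vx≡ vy≡ (ternary-InG k xs ys (∷-injectiveʳ z≡0))

theorem3p4 : (n : ℕ) (x y : Vec Trit n) →
    weighted (vadd x y) ≡ weighted x + weighted y →
    zvec x y ≡ replicate n z0 →
    InSF (ternary x) (ternary y)
theorem3p4 n x y _ z≡0 k = ternary-InG k x y z≡0
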